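{- $S_w(n,2) = \Theta(n^2)$; that is, there are constants $c, C > 0$ such that $c n^2 \leq S_w(n,2) \leq C n^2$ for all sufficiently large $n$.
   Context: Permutation Mastermind on $n \geq 2$: a secret $\sigma^\star \in S_n$ is chosen; a guess $\pi \in S_n$ receives the black-peg score $b(\pi,\sigma^\star) := |\{i \in [n] : \pi(i) = \sigma^\star(i)\}|$. A static strategy is a fixed list of guesses $(\pi_1,\dots,\pi_T)$ announced in advance; the codemaker then reveals all the scores $b(\pi_t,\sigma^\star)$, after which the codebreaker makes one final guess, which must equal $\sigma^\star$ for the strategy to be correct (for every $\sigma^\star$). For $\pi,\sigma\in S_n$ let $D(\pi,\sigma) := \{i : \pi(i)\neq\sigma(i)\}$. A static strategy is $w_k$-local if for all $1 \le t < T$, $\max D(\pi_t,\pi_{t+1}) - \min D(\pi_t,\pi_{t+1}) \leq k-1$ (i.e. consecutive guesses differ only inside a window of $k$ consecutive positions); the final guess is not subject to this restriction. $S_w(n,k)$ is the minimum length $T$ of the list of a correct $w_k$-local static strategy. -}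

module Defs where

open import Data.Nat using (ℕ; _+_; _∸_; _≤_)
open import Data.Fin using (Fin; toℕ; _≟_)
open import Data.Fin.Permutation using (Permutation′; _⟨$⟩ʳ_)
open import Data.List using (List; []; _∷_; length; filter; map; allFin)
open import Data.Unit using (⊤)
open import Data.Product using (∃; _×_)
open import Relation.Binary.PropositionalEquality using (_≡_; _≢_)

-- Permutations of [n] (positions and colours are Fin n).
Perm : ℕ → Set
Perm n = Permutation′ n

_≈ₚ_ : ∀ {n} → Perm n → Perm n → Set
π ≈ₚ σ = ∀ i → π ⟨$⟩ʳ i ≡ σ ⟨$⟩ʳ i

blackPegs : ∀ {n} → Perm n → Perm n → ℕ
blackPegs {n} π σ =
  length (filter (λ i → (π ⟨$⟩ʳ i) ≟ (σ ⟨$⟩ʳ i)) (allFin n))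

scores : ∀ {n} → List (Perm n) → Perm n → List ℕ
scores guesses σ = map (λ π → blackPegs π σ) guesses

Correct : ∀ {n} → List (Perm n) → Set
Correct {n} guesses =
  ∃ λ (final : List ℕ → Perm n) → ∀ σ → final (scores guesses σ) ≈ₚ σ

-- max D(π,σ) - min D(π,σ) ≤ k - 1, where D(π,σ) = { i : π(i) ≠ σ(i) }
-- (vacuous when D is empty): any two positions in D are at distance ≤ k-1.
WithinWindow : ∀ {n} → ℕ → Perm n → Perm n → Set
WithinWindow k π σ =
  ∀ i j → π ⟨$⟩ʳ i ≢ σ ⟨$⟩ʳ i → π ⟨$⟩ʳ j ≢ σ ⟨$⟩ʳ j → toℕ j ≤ toℕ i + (k ∸ 1)

Local : ∀ {n} → ℕ → List (Perm n) → Set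
Local k [] = ⊤
Local k (π ∷ []) = ⊤
Local k (π ∷ σ ∷ rest) = WithinWindow k π σ × Local k (σ ∷ rest)

{-# OPTIONS --safe #-}
-- Call a pair (position, colour) seen if some guess shows that colour at that
-- position.  If distinct positions i, j had distinct colours a, b unseen at both, a secret with
-- colours a, b at i, j and the secret with these two values swapped would get identical scores.
-- So for a correct strategy any two positions together see at least n - 1 colours, all
-- positions but one see at least (n - 1)/2 colours, and at least (n - 1)²/2 pairs are seen.  The
-- first guess sees n pairs and every w₂-local step changes at most two positions, so T guesses
-- see at most n + 2T pairs; this gives n² ≤ 8T once n ≥ 8.
--
-- For every colour c, start from the identity, carry c by adjacent transpositions
-- to the last position and back, then to the first position and back: 2n guesses per colour.
-- If secrets σ, τ get equal scores, then for a guess ρ and its transposition at positions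
-- k, l = p, p + 1 the two score changes agree, which says that the imbalance
-- [σ k = c] + [τ l = c] - [τ k = c] - [σ l = c] takes the same value at the colours ρ k and ρ l.
-- The walks give such steps joining every colour to p or p + 1, so the imbalance does not
-- depend on c, and comparing its values at σ k and at τ k forces σ k = τ k.
module Submission where

open import Defs
open import Data.Nat using (ℕ; _*_; _≤_; _^_)
open import Data.List using (List; length)
open import Data.Product using (_×_; ∃)
open import Data.Empty using (⊥-elim)
open import Data.Fin using (Fin; toℕ; _≟_; punchIn; punchOut; inject₁; fromℕ)
  renaming (zero to fzero; suc to fsuc)
import Data.Fin.Properties as Fin
open import Data.Fin.Properties using (toℕ-inject₁; toℕ-fromℕ; toℕ<n; toℕ-injective; <⇒≢)
open import Data.Fin.Permutation
  using (_⟨$⟩ʳ_; _⟨$⟩ˡ_; inverseˡ; transpose; _∘ₚ_; id; insert; remove; insert-remove)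
open import Data.Integer using (ℤ; _⊖_; -_)
open import Data.Integer.Properties using (+-cancelˡ-⊖; ⊖-swap)
open import Data.List using ([]; _∷_; _++_; map; filter; tabulate; allFin; cartesianProductWith; concatMap)
import Data.List.Properties as List
open import Data.List.Membership.Propositional using (_∈_; lose)
open import Data.List.Membership.Propositional.Properties using (∈-allFin; ∈-++⁺ˡ; ∈-++⁺ʳ; ∈-map⁺; ∈-concat⁺′)
open import Data.List.Relation.Binary.Subset.Propositional using (_⊆_)
open import Data.List.Relation.Unary.Any as Any using (Any; here; there; any?; satisfied)
open import Data.List.Relation.Unary.Any.Properties using (cartesianProductWith⁺)
import Data.Nat as ℕ
open import Data.Nat using (zero; suc; _+_; _∸_; _<_; z≤n; s≤s; s≤s⁻¹; _<?_; _≤?_)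
open import Data.Nat.Properties
  using ( +-0-commutativeMonoid; +-commutativeSemigroup; module ≤-Reasoning
        ; ≤-refl; ≤-reflexive; ≤-trans; <-trans; <-≤-trans; <-asym; <⇒≱; ≮⇒≥; ≰⇒>; ≤∧≢⇒<; n≮0; n≤1+n
        ; m≤m+n; m≤n+m; +-mono-≤; +-monoʳ-≤; +-monoˡ-≤; *-monoˡ-≤
        ; +-assoc; +-comm; +-suc; +-identityʳ; *-zeroʳ; *-identityʳ; +-cancelˡ-≡; +-cancelˡ-≤; +-cancelˡ-<
        )
open import Data.Nat.Tactic.RingSolver using (solve-∀)
import Data.Product as Product
open import Data.Product using (_,_; proj₁; proj₂)
open import Data.Sum using (_⊎_; inj₁; inj₂)
open import Data.Unit using (tt)
open import Data.Vec.Functional using (updateAt)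
open import Data.Vec.Functional.Properties using (updateAt-updates; updateAt-minimal)
open import Function using (_∘_; _⇔_; Equivalence; mk⇔)
open import Relation.Binary.PropositionalEquality
open import Relation.Nullary using (Dec; yes; no; ¬_; ¬?)
open import Algebra.Properties.CommutativeSemigroup +-commutativeSemigroup
  using (xy∙z≈zy∙x; xy∙z≈xz∙y; xy∙z≈x∙zy; interchange)
open import Algebra.Properties.CommutativeMonoid.Sum +-0-commutativeMonoid
  using (sum; sum-syntax; sum-cong-≗; ∑-distrib-+)

private
  variable
    n : ℕ

-- Indicators and finite sums

𝟙 : ∀ {P : Set} → Dec P → ℕ
𝟙 (yes _) = 1
𝟙 (no _) = 0

𝟙≤1 : ∀ {P : Set} (p? : Dec P) → 𝟙 p? ≤ 1
𝟙≤1 (yes _) = s≤s z≤n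
𝟙≤1 (no _) = z≤n

𝟙-yes : ∀ {P : Set} (p? : Dec P) → P → 𝟙 p? ≡ 1
𝟙-yes (yes _) _ = refl
𝟙-yes (no ¬p) p = ⊥-elim (¬p p)

𝟙-no : ∀ {P : Set} (p? : Dec P) → ¬ P → 𝟙 p? ≡ 0
𝟙-no (yes p) ¬p = ⊥-elim (¬p p)
𝟙-no (no _) _ = refl

𝟙-witness : ∀ {P : Set} (p? : Dec P) → 0 < 𝟙 p? → P
𝟙-witness (yes p) _ = p

𝟙-none : ∀ {P : Set} (p? : Dec P) → 𝟙 p? ≤ 0 → ¬ P
𝟙-none (no ¬p) _ = ¬p

𝟙-cong : ∀ {P Q : Set} (p? : Dec P) (q? : Dec Q) → P ⇔ Q → 𝟙 p? ≡ 𝟙 q?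
𝟙-cong (yes _) (yes _) _ = refl
𝟙-cong (yes p) (no ¬q) P⇔Q = ⊥-elim (¬q (Equivalence.to P⇔Q p))
𝟙-cong (no ¬p) (yes q) P⇔Q = ⊥-elim (¬p (Equivalence.from P⇔Q q))
𝟙-cong (no _) (no _) _ = refl

𝟙-mono : ∀ {P Q : Set} (p? : Dec P) (q? : Dec Q) → (P → Q) → 𝟙 p? ≤ 𝟙 q?
𝟙-mono (yes p) (yes _) _ = ≤-refl
𝟙-mono (yes p) (no ¬q) P→Q = ⊥-elim (¬q (P→Q p))
𝟙-mono (no _) q? _ = z≤n

𝟙-⊎ : ∀ {P Q R : Set} (p? : Dec P) (q? : Dec Q) (r? : Dec R) → (P → Q ⊎ R) → 𝟙 p? ≤ 𝟙 q? + 𝟙 r?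
𝟙-⊎ (no _) q? r? _ = z≤n
𝟙-⊎ (yes p) q? r? P→Q⊎R with P→Q⊎R p
... | inj₁ q = ≤-trans (𝟙-mono (yes q) q? λ q → q) (m≤m+n _ _)
... | inj₂ r = ≤-trans (𝟙-mono (yes r) r? λ r → r) (m≤n+m _ _)

sum-mono : ∀ {f g : Fin n → ℕ} → (∀ i → f i ≤ g i) → sum f ≤ sum g
sum-mono {zero} f≤g = z≤n
sum-mono {suc n} f≤g = +-mono-≤ (f≤g fzero) (sum-mono (f≤g ∘ fsuc))

sum-const : (c : ℕ) → sum {n} (λ _ → c) ≡ n * c
sum-const {zero} c = refl
sum-const {suc n} c = cong (c +_) (sum-const {n} c)

sum-zero : sum {n} (λ _ → 0) ≡ 0
sum-zero {n} = trans (sum-const {n} 0) (*-zeroʳ n)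

sum-𝟙-≟ : (x : Fin n) → sum (λ a → 𝟙 (x ≟ a)) ≡ 1
sum-𝟙-≟ {suc n} fzero = cong suc (sum-zero {n})
sum-𝟙-≟ {suc n} (fsuc x) =
  trans (sum-cong-≗ (λ a → 𝟙-cong (fsuc x ≟ fsuc a) (x ≟ a) (mk⇔ Fin.suc-injective (cong fsuc)))) (sum-𝟙-≟ x)

sum-agree-except : (f g : Fin n → ℕ) (i : Fin n) → (∀ j → j ≢ i → f j ≡ g j) → sum f + g i ≡ sum g + f i
sum-agree-except f g fzero agree = begin
  f fzero + sum (f ∘ fsuc) + g fzero   ≡⟨ cong (λ s → f fzero + s + g fzero) (sum-cong-≗ agree′) ⟩
  f fzero + sum (g ∘ fsuc) + g fzero   ≡⟨ xy∙z≈zy∙x (f fzero) _ _ ⟩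
  g fzero + sum (g ∘ fsuc) + f fzero   ∎
  where
  open ≡-Reasoning
  agree′ : ∀ j → f (fsuc j) ≡ g (fsuc j)
  agree′ j = agree (fsuc j) λ ()
sum-agree-except f g (fsuc i) agree = begin
  f fzero + sum (f ∘ fsuc) + g (fsuc i)     ≡⟨ +-assoc (f fzero) _ _ ⟩
  f fzero + (sum (f ∘ fsuc) + g (fsuc i))   ≡⟨ cong₂ _+_ (agree fzero λ ()) (sum-agree-except _ _ i agree′) ⟩
  g fzero + (sum (g ∘ fsuc) + f (fsuc i))   ≡⟨ +-assoc (g fzero) _ _ ⟨
  g fzero + sum (g ∘ fsuc) + f (fsuc i)     ∎
  where
  open ≡-Reasoning
  agree′ : ∀ j → j ≢ i → f (fsuc j) ≡ g (fsuc j)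
  agree′ j j≢i = agree (fsuc j) (j≢i ∘ Fin.suc-injective)

sum-agree-except₂ : (f g : Fin n → ℕ) {i j : Fin n} → i ≢ j → (∀ k → k ≢ i → k ≢ j → f k ≡ g k) →
                    sum f + (g i + g j) ≡ sum g + (f i + f j)
sum-agree-except₂ f g {i} {j} i≢j agree = begin
  sum f + (g i + g j) ≡⟨ +-assoc (sum f) _ _ ⟨
  sum f + g i + g j   ≡⟨ cong (λ x → sum f + x + g j) (updateAt-updates i f) ⟨
  sum f + h i + g j   ≡⟨ cong (_+ g j) (sum-agree-except f h i f≡h) ⟩
  sum h + f i + g j   ≡⟨ xy∙z≈xz∙y (sum h) _ _ ⟩
  sum h + g j + f i   ≡⟨ cong (_+ f i) (sum-agree-except h g j h≡g) ⟩
  sum g + h j + f i   ≡⟨ cong (λ x → sum g + x + f i) (updateAt-minimal j i f (i≢j ∘ sym)) ⟩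
  sum g + f j + f i   ≡⟨ xy∙z≈x∙zy (sum g) _ _ ⟩
  sum g + (f i + f j) ∎
  where
  open ≡-Reasoning
  h : Fin _ → ℕ
  h = updateAt f i (λ _ → g i)
  f≡h : ∀ k → k ≢ i → f k ≡ h k
  f≡h k k≢i = sym (updateAt-minimal k i f k≢i)
  h≡g : ∀ k → k ≢ j → h k ≡ g k
  h≡g k k≢j with k ≟ i
  ... | yes refl = updateAt-updates i f
  ... | no k≢i = trans (updateAt-minimal k i f k≢i) (agree k k≢i k≢j)

sum-all-but-one : (f : Fin n → ℕ) (c : ℕ) → (∀ i j → f i < c → f j < c → i ≡ j) → (n ∸ 1) * c ≤ sum f
sum-all-but-one {zero} f c _ = z≤n
sum-all-but-one {suc n} f c small-unique with c ≤? f fzero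
... | yes c≤f₀ = begin
  n * c                      ≤⟨ n*c≤c+[n∸1]*c n ⟩
  c + (n ∸ 1) * c            ≤⟨ +-mono-≤ c≤f₀ (sum-all-but-one (f ∘ fsuc) c small-unique′) ⟩
  f fzero + sum (f ∘ fsuc)   ∎
  where
  open ≤-Reasoning
  n*c≤c+[n∸1]*c : ∀ n → n * c ≤ c + (n ∸ 1) * c
  n*c≤c+[n∸1]*c zero = z≤n
  n*c≤c+[n∸1]*c (suc n) = ≤-refl
  small-unique′ : ∀ i j → f (fsuc i) < c → f (fsuc j) < c → i ≡ j
  small-unique′ i j p q = Fin.suc-injective (small-unique _ _ p q)
... | no c≰f₀ = begin
  n * c                      ≡⟨ sum-const {n} c ⟨
  sum {n} (λ _ → c)          ≤⟨ sum-mono c≤f ⟩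
  sum (f ∘ fsuc)             ≤⟨ m≤n+m _ _ ⟩
  f fzero + sum (f ∘ fsuc)   ∎
  where
  open ≤-Reasoning
  c≤f : ∀ i → c ≤ f (fsuc i)
  c≤f i = ≮⇒≥ λ fᵢ<c → Fin.0≢1+n (small-unique fzero (fsuc i) (≰⇒> c≰f₀) fᵢ<c)

sum-supported-below : (k : ℕ) (f : Fin n → ℕ) → (∀ i → f i ≤ 1) → (∀ i → 0 < f i → toℕ i < k) → sum f ≤ k
sum-supported-below {zero} _ _ _ _ = z≤n
sum-supported-below {suc n} zero f f≤1 support =
  +-mono-≤ (≮⇒≥ (n≮0 ∘ support fzero))
           (sum-supported-below zero (f ∘ fsuc) (f≤1 ∘ fsuc) λ i → ⊥-elim ∘ n≮0 ∘ support (fsuc i))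
sum-supported-below {suc n} (suc k) f f≤1 support =
  +-mono-≤ (f≤1 fzero) (sum-supported-below k (f ∘ fsuc) (f≤1 ∘ fsuc) λ i → s≤s⁻¹ ∘ support (fsuc i))

sum-supported-in-window : (k : ℕ) (f : Fin n → ℕ) → (∀ i → f i ≤ 1) →
                          (∀ i j → 0 < f i → 0 < f j → toℕ j ≤ toℕ i + k) → sum f ≤ suc k
sum-supported-in-window {zero} _ _ _ _ = z≤n
sum-supported-in-window {suc n} k f f≤1 window with 0 <? f fzero
... | yes f₀>0 =
  +-mono-≤ (f≤1 fzero) (sum-supported-below k (f ∘ fsuc) (f≤1 ∘ fsuc) λ i → window fzero (fsuc i) f₀>0)
... | no f₀≯0 =
  +-mono-≤ (≮⇒≥ f₀≯0)
           (sum-supported-in-window k (f ∘ fsuc) (f≤1 ∘ fsuc) λ i j p q → s≤s⁻¹ (window (fsuc i) (fsuc j) p q))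

-- Permutations and scores

transpose-left : (i j : Fin n) → transpose i j ⟨$⟩ʳ i ≡ j
transpose-left i j with i ≟ i
... | yes _ = refl
... | no i≢i = ⊥-elim (i≢i refl)

transpose-right : (i j : Fin n) → transpose i j ⟨$⟩ʳ j ≡ i
transpose-right i j with j ≟ i
... | yes refl = refl
... | no _ with j ≟ j
...   | yes _ = refl
...   | no j≢j = ⊥-elim (j≢j refl)

transpose-other : {i j k : Fin n} → k ≢ i → k ≢ j → transpose i j ⟨$⟩ʳ k ≡ k
transpose-other {i = i} {j} {k} k≢i k≢j with k ≟ i
... | yes k≡i = ⊥-elim (k≢i k≡i)
... | no _ with k ≟ j
...   | yes k≡j = ⊥-elim (k≢j k≡j)
...   | no _ = refl

moved-by-transpose : (π : Perm n) {k l i : Fin n} → π ⟨$⟩ʳ i ≢ (transpose k l ∘ₚ π) ⟨$⟩ʳ i → i ≡ k ⊎ i ≡ l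
moved-by-transpose π {k} {l} {i} moved = by-cases (i ≟ k) (i ≟ l)
  where
  by-cases : Dec (i ≡ k) → Dec (i ≡ l) → i ≡ k ⊎ i ≡ l
  by-cases (yes i≡k) _ = inj₁ i≡k
  by-cases (no _) (yes i≡l) = inj₂ i≡l
  by-cases (no i≢k) (no i≢l) = ⊥-elim (moved (cong (π ⟨$⟩ʳ_) (sym (transpose-other i≢k i≢l))))

⟨$⟩ʳ-injective : (π : Perm n) {i j : Fin n} → π ⟨$⟩ʳ i ≡ π ⟨$⟩ʳ j → i ≡ j
⟨$⟩ʳ-injective π {i} {j} eq = begin
  i                      ≡⟨ inverseˡ π ⟨
  π ⟨$⟩ˡ (π ⟨$⟩ʳ i)      ≡⟨ cong (π ⟨$⟩ˡ_) eq ⟩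
  π ⟨$⟩ˡ (π ⟨$⟩ʳ j)      ≡⟨ inverseˡ π ⟩
  j                      ∎
  where open ≡-Reasoning

perm-sending : {i j a b : Fin n} → i ≢ j → a ≢ b → ∃ λ (σ : Perm n) → σ ⟨$⟩ʳ i ≡ a × σ ⟨$⟩ʳ j ≡ b
perm-sending {i = i} {j} {a} {b} i≢j a≢b = ρ ∘ₚ transpose (ρ ⟨$⟩ʳ j) b , σi≡a , transpose-left (ρ ⟨$⟩ʳ j) b
  where
  ρ : Perm _
  ρ = transpose i a
  σi≡a : transpose (ρ ⟨$⟩ʳ j) b ⟨$⟩ʳ (ρ ⟨$⟩ʳ i) ≡ a
  σi≡a rewrite transpose-left i a =
    transpose-other (λ a≡ρj → i≢j (⟨$⟩ʳ-injective ρ (trans (transpose-left i a) a≡ρj))) a≢b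

allPerms : (n : ℕ) → List (Perm n)
allPerms zero = id ∷ []
allPerms (suc n) = cartesianProductWith (insert fzero) (allFin (suc n)) (allPerms n)

insert-cong : (i j : Fin (suc n)) {π ρ : Perm n} → π ≈ₚ ρ → insert i j π ≈ₚ insert i j ρ
insert-cong i j π≈ρ k with i ≟ k
... | yes _ = refl
... | no i≢k = cong (punchIn j) (π≈ρ (punchOut i≢k))

allPerms-complete : (σ : Perm n) → Any (_≈ₚ σ) (allPerms n)
allPerms-complete {zero} σ = here λ ()
allPerms-complete {suc n} σ =
  cartesianProductWith⁺ (insert fzero) inserted (∈-allFin (σ ⟨$⟩ʳ fzero)) (allPerms-complete (remove fzero σ))
  where
  inserted : ∀ {j ρ} → σ ⟨$⟩ʳ fzero ≡ j → ρ ≈ₚ remove fzero σ → insert fzero j ρ ≈ₚ σ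
  inserted refl ρ≈σ₋ k = trans (insert-cong fzero _ ρ≈σ₋ k) (insert-remove fzero σ k)

length-filter-tabulate : ∀ {A : Set} {P : A → Set} (P? : ∀ x → Dec (P x)) (f : Fin n → A) →
                         length (filter P? (tabulate f)) ≡ sum (λ k → 𝟙 (P? (f k)))
length-filter-tabulate {zero} P? f = refl
length-filter-tabulate {suc n} P? f with P? (f fzero)
... | yes _ = cong suc (length-filter-tabulate P? (f ∘ fsuc))
... | no _ = length-filter-tabulate P? (f ∘ fsuc)

blackPegs-sum : (π σ : Perm n) → blackPegs π σ ≡ sum (λ k → 𝟙 (π ⟨$⟩ʳ k ≟ σ ⟨$⟩ʳ k))
blackPegs-sum π σ = length-filter-tabulate (λ k → π ⟨$⟩ʳ k ≟ σ ⟨$⟩ʳ k) (λ k → k)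

blackPegs-cong : (π σ π′ σ′ : Perm n) → (∀ k → (π ⟨$⟩ʳ k ≡ σ ⟨$⟩ʳ k) ⇔ (π′ ⟨$⟩ʳ k ≡ σ′ ⟨$⟩ʳ k)) →
                 blackPegs π σ ≡ blackPegs π′ σ′
blackPegs-cong π σ π′ σ′ agree = begin
  blackPegs π σ                                  ≡⟨ blackPegs-sum π σ ⟩
  sum (λ k → 𝟙 (π ⟨$⟩ʳ k ≟ σ ⟨$⟩ʳ k))            ≡⟨ sum-cong-≗ (λ k → 𝟙-cong _ _ (agree k)) ⟩
  sum (λ k → 𝟙 (π′ ⟨$⟩ʳ k ≟ σ′ ⟨$⟩ʳ k))          ≡⟨ blackPegs-sum π′ σ′ ⟨
  blackPegs π′ σ′                                ∎
  where open ≡-Reasoning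

blackPegs-transpose : (π σ : Perm n) {k l : Fin n} → k ≢ l →
  blackPegs π σ + (𝟙 (π ⟨$⟩ʳ l ≟ σ ⟨$⟩ʳ k) + 𝟙 (π ⟨$⟩ʳ k ≟ σ ⟨$⟩ʳ l)) ≡
  blackPegs (transpose k l ∘ₚ π) σ + (𝟙 (π ⟨$⟩ʳ k ≟ σ ⟨$⟩ʳ k) + 𝟙 (π ⟨$⟩ʳ l ≟ σ ⟨$⟩ʳ l))
blackPegs-transpose π σ {k} {l} k≢l = begin
  blackPegs π σ + (𝟙 (π ⟨$⟩ʳ l ≟ σ ⟨$⟩ʳ k) + 𝟙 (π ⟨$⟩ʳ k ≟ σ ⟨$⟩ʳ l))
    ≡⟨ cong₂ _+_ (blackPegs-sum π σ)
                 (cong₂ _+_ (moved k l (transpose-left k l)) (moved l k (transpose-right k l))) ⟩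
  sum f + (g k + g l)
    ≡⟨ sum-agree-except₂ f g k≢l (λ i i≢k i≢l → moved i i (transpose-other i≢k i≢l)) ⟩
  sum g + (f k + f l)
    ≡⟨ cong (_+ (f k + f l)) (blackPegs-sum π′ σ) ⟨
  blackPegs π′ σ + (f k + f l) ∎
  where
  open ≡-Reasoning
  π′ = transpose k l ∘ₚ π
  f g : Fin _ → ℕ
  f i = 𝟙 (π ⟨$⟩ʳ i ≟ σ ⟨$⟩ʳ i)
  g i = 𝟙 (π′ ⟨$⟩ʳ i ≟ σ ⟨$⟩ʳ i)
  moved : ∀ i j → transpose k l ⟨$⟩ʳ i ≡ j → 𝟙 (π ⟨$⟩ʳ j ≟ σ ⟨$⟩ʳ i) ≡ g i
  moved i j eq = cong (λ x → 𝟙 (π ⟨$⟩ʳ x ≟ σ ⟨$⟩ʳ i)) (sym eq)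

blackPegs-transpose-secret : (π σ : Perm n) {i j : Fin n} →
  π ⟨$⟩ʳ i ≢ σ ⟨$⟩ʳ i → π ⟨$⟩ʳ i ≢ σ ⟨$⟩ʳ j → π ⟨$⟩ʳ j ≢ σ ⟨$⟩ʳ i → π ⟨$⟩ʳ j ≢ σ ⟨$⟩ʳ j →
  blackPegs π σ ≡ blackPegs π (transpose i j ∘ₚ σ)
blackPegs-transpose-secret π σ {i} {j} πi≢σi πi≢σj πj≢σi πj≢σj = blackPegs-cong π σ π σ′ agree
  where
  neither : ∀ {P Q : Set} → ¬ P → ¬ Q → P ⇔ Q
  neither ¬p ¬q = mk⇔ (⊥-elim ∘ ¬p) (⊥-elim ∘ ¬q)
  σ′ = transpose i j ∘ₚ σ
  agree : ∀ k → (π ⟨$⟩ʳ k ≡ σ ⟨$⟩ʳ k) ⇔ (π ⟨$⟩ʳ k ≡ σ′ ⟨$⟩ʳ k)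
  agree k = by-cases (k ≟ i) (k ≟ j)
    where
    by-cases : Dec (k ≡ i) → Dec (k ≡ j) → (π ⟨$⟩ʳ k ≡ σ ⟨$⟩ʳ k) ⇔ (π ⟨$⟩ʳ k ≡ σ′ ⟨$⟩ʳ k)
    by-cases (yes refl) _ = neither πi≢σi λ e → πi≢σj (trans e (cong (σ ⟨$⟩ʳ_) (transpose-left i j)))
    by-cases (no _) (yes refl) = neither πj≢σj λ e → πj≢σi (trans e (cong (σ ⟨$⟩ʳ_) (transpose-right i j)))
    by-cases (no k≢i) (no k≢j) = mk⇔ (λ e → trans e (sym σ′k≡σk)) (λ e → trans e σ′k≡σk)
      where σ′k≡σk = cong (σ ⟨$⟩ʳ_) (transpose-other k≢i k≢j)

scores-≡⁺ : (gs : List (Perm n)) (σ τ : Perm n) → (∀ {π} → π ∈ gs → blackPegs π σ ≡ blackPegs π τ) →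
            scores gs σ ≡ scores gs τ
scores-≡⁺ [] σ τ _ = refl
scores-≡⁺ (π ∷ gs) σ τ agree = cong₂ _∷_ (agree (here refl)) (scores-≡⁺ gs σ τ λ π∈gs → agree (there π∈gs))

scores-≡⁻ : (gs : List (Perm n)) (σ τ : Perm n) → scores gs σ ≡ scores gs τ →
            ∀ {π} → π ∈ gs → blackPegs π σ ≡ blackPegs π τ
scores-≡⁻ (_ ∷ _) σ τ eq (here refl) = List.∷-injectiveˡ eq
scores-≡⁻ (_ ∷ gs) σ τ eq (there π∈gs) = scores-≡⁻ gs σ τ (List.∷-injectiveʳ eq) π∈gs

scores-cong : (gs : List (Perm n)) {σ τ : Perm n} → σ ≈ₚ τ → scores gs σ ≡ scores gs τ
scores-cong gs {σ} {τ} σ≈τ = scores-≡⁺ gs σ τ λ {π} _ → blackPegs-cong π σ π τ λ k →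
  mk⇔ (λ e → trans e (σ≈τ k)) (λ e → trans e (sym (σ≈τ k)))

Correct⇒injective : {gs : List (Perm n)} → Correct gs → ∀ {σ τ} → scores gs σ ≡ scores gs τ → σ ≈ₚ τ
Correct⇒injective (decode , decode-correct) {σ} {τ} eq k = begin
  σ ⟨$⟩ʳ k                        ≡⟨ decode-correct σ k ⟨
  decode (scores _ σ) ⟨$⟩ʳ k      ≡⟨ cong (λ s → decode s ⟨$⟩ʳ k) eq ⟩
  decode (scores _ τ) ⟨$⟩ʳ k      ≡⟨ decode-correct τ k ⟩
  τ ⟨$⟩ʳ k                        ∎
  where open ≡-Reasoning

injective⇒Correct : {gs : List (Perm n)} → (∀ {σ τ} → scores gs σ ≡ scores gs τ → σ ≈ₚ τ) → Correct gs
injective⇒Correct {n} {gs} injective = (λ s → decode (search s)) , λ σ → decode-correct σ (search (scores gs σ))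
  where
  Explains : List ℕ → Perm n → Set
  Explains s τ = scores gs τ ≡ s
  search : (s : List ℕ) → Dec (Any (Explains s) (allPerms n))
  search s = any? (λ τ → List.≡-dec ℕ._≟_ (scores gs τ) s) (allPerms n)
  decode : ∀ {s} → Dec (Any (Explains s) (allPerms n)) → Perm n
  decode (yes found) = proj₁ (satisfied found)
  decode (no _) = id
  decode-correct : ∀ σ (found? : Dec (Any (Explains (scores gs σ)) (allPerms n))) → decode found? ≈ₚ σ
  decode-correct σ (yes found) = injective {proj₁ (satisfied found)} {σ} (proj₂ (satisfied found))
  decode-correct σ (no none) = ⊥-elim (none (Any.map (λ {τ} → scores-cong gs {τ} {σ}) (allPerms-complete σ)))

-- The lower bound

Seen : List (Perm n) → Fin n → Fin n → Set
Seen gs k a = Any (λ π → π ⟨$⟩ʳ k ≡ a) gs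

seen? : (gs : List (Perm n)) (k a : Fin n) → Dec (Seen gs k a)
seen? gs k a = any? (λ π → π ⟨$⟩ʳ k ≟ a) gs

coloursSeen : List (Perm n) → Fin n → ℕ
coloursSeen {n} gs k = ∑[ a < n ] 𝟙 (seen? gs k a)

pairsSeen : List (Perm n) → ℕ
pairsSeen {n} gs = ∑[ k < n ] coloursSeen gs k

coloursSeen-[] : (k : Fin n) → coloursSeen [] k ≡ 0
coloursSeen-[] {n} k = sum-zero {n}

coloursSeen-∷ : (π : Perm n) (gs : List (Perm n)) (k : Fin n) → coloursSeen (π ∷ gs) k ≤ 1 + coloursSeen gs k
coloursSeen-∷ {n} π gs k = begin
  coloursSeen (π ∷ gs) k                             ≤⟨ sum-mono here-or-later ⟩
  ∑[ a < n ] (𝟙 (π ⟨$⟩ʳ k ≟ a) + 𝟙 (seen? gs k a))   ≡⟨ ∑-distrib-+ {n} _ _ ⟩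
  ∑[ a < n ] 𝟙 (π ⟨$⟩ʳ k ≟ a) + coloursSeen gs k     ≡⟨ cong (_+ coloursSeen gs k) (sum-𝟙-≟ (π ⟨$⟩ʳ k)) ⟩
  1 + coloursSeen gs k                               ∎
  where
  open ≤-Reasoning
  here-or-later : ∀ a → 𝟙 (seen? (π ∷ gs) k a) ≤ 𝟙 (π ⟨$⟩ʳ k ≟ a) + 𝟙 (seen? gs k a)
  here-or-later a = 𝟙-⊎ (seen? (π ∷ gs) k a) (π ⟨$⟩ʳ k ≟ a) (seen? gs k a) Any.toSum

coloursSeen-step : (π π′ : Perm n) (gs : List (Perm n)) (k : Fin n) →
                   coloursSeen (π ∷ π′ ∷ gs) k ≤ coloursSeen (π′ ∷ gs) k + 𝟙 (¬? (π ⟨$⟩ʳ k ≟ π′ ⟨$⟩ʳ k))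
coloursSeen-step π π′ gs k with π ⟨$⟩ʳ k ≟ π′ ⟨$⟩ʳ k
... | yes πk≡π′k = ≤-trans (sum-mono λ a → 𝟙-mono _ _ (seen-by-π′ a)) (≤-reflexive (sym (+-identityʳ _)))
  where
  seen-by-π′ : ∀ a → Seen (π ∷ π′ ∷ gs) k a → Seen (π′ ∷ gs) k a
  seen-by-π′ a (here πk≡a) = here (trans (sym πk≡π′k) πk≡a)
  seen-by-π′ a (there seen) = seen
... | no _ = ≤-trans (coloursSeen-∷ π (π′ ∷ gs) k) (≤-reflexive (+-comm 1 _))

changed-positions≤ : (w : ℕ) {π π′ : Perm n} → WithinWindow (suc w) π π′ →
                        ∑[ k < n ] 𝟙 (¬? (π ⟨$⟩ʳ k ≟ π′ ⟨$⟩ʳ k)) ≤ suc w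
changed-positions≤ w window =
  sum-supported-in-window w _ (λ k → 𝟙≤1 _) λ i j p q → window i j (𝟙-witness _ p) (𝟙-witness _ q)

Local⇒pairsSeen≤ : (w : ℕ) (gs : List (Perm n)) → Local (suc w) gs → pairsSeen gs ≤ n + suc w * length gs
Local⇒pairsSeen≤ {n} w [] _ =
  ≤-trans (≤-reflexive (trans (sum-cong-≗ {n} (coloursSeen-[] {n})) (sum-zero {n}))) z≤n
Local⇒pairsSeen≤ {n} w (π ∷ []) _ = begin
  pairsSeen (π ∷ [])    ≤⟨ sum-mono (λ k → subst (coloursSeen (π ∷ []) k ≤_) (cong suc (coloursSeen-[] k)) (coloursSeen-∷ π [] k)) ⟩
  ∑[ k < n ] 1          ≡⟨ trans (sum-const {n} 1) (*-identityʳ n) ⟩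
  n                     ≤⟨ m≤m+n n _ ⟩
  n + suc w * 1         ∎
  where open ≤-Reasoning
Local⇒pairsSeen≤ {n} w (π ∷ π′ ∷ gs) (window , local) = begin
  pairsSeen (π ∷ π′ ∷ gs)
    ≤⟨ sum-mono (coloursSeen-step π π′ gs) ⟩
  ∑[ k < n ] (coloursSeen (π′ ∷ gs) k + 𝟙 (¬? (π ⟨$⟩ʳ k ≟ π′ ⟨$⟩ʳ k)))
    ≡⟨ ∑-distrib-+ {n} _ _ ⟩
  pairsSeen (π′ ∷ gs) + ∑[ k < n ] 𝟙 (¬? (π ⟨$⟩ʳ k ≟ π′ ⟨$⟩ʳ k))
    ≤⟨ +-mono-≤ (Local⇒pairsSeen≤ w (π′ ∷ gs) local) (changed-positions≤ w {π} {π′} window) ⟩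
  n + suc w * length (π′ ∷ gs) + suc w
    ≡⟨ n+s*L+s≡n+s*[1+L] n (suc w) (length (π′ ∷ gs)) ⟩
  n + suc w * length (π ∷ π′ ∷ gs) ∎
  where
  open ≤-Reasoning
  n+s*L+s≡n+s*[1+L] : ∀ n s L → n + s * L + s ≡ n + s * suc L
  n+s*L+s≡n+s*[1+L] = solve-∀

Correct⇒unseen-unique : {gs : List (Perm n)} → Correct gs → {i j a b : Fin n} → i ≢ j →
  ¬ Seen gs i a → ¬ Seen gs j a → ¬ Seen gs i b → ¬ Seen gs j b → a ≡ b
Correct⇒unseen-unique {gs = gs} correct {i} {j} {a} {b} i≢j ¬ia ¬ja ¬ib ¬jb with a ≟ b
... | yes a≡b = a≡b
... | no a≢b = begin
  a                   ≡⟨ σi≡a ⟨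
  σ ⟨$⟩ʳ i            ≡⟨ Correct⇒injective correct {σ} {σ′} same-scores i ⟩
  σ′ ⟨$⟩ʳ i           ≡⟨ cong (σ ⟨$⟩ʳ_) (transpose-left i j) ⟩
  σ ⟨$⟩ʳ j            ≡⟨ σj≡b ⟩
  b                   ∎
  where
  open ≡-Reasoning
  σ = proj₁ (perm-sending i≢j a≢b)
  σi≡a = proj₁ (proj₂ (perm-sending i≢j a≢b))
  σj≡b = proj₂ (proj₂ (perm-sending i≢j a≢b))
  σ′ = transpose i j ∘ₚ σ
  unseen : ∀ {π k c} → ¬ Seen gs k c → π ∈ gs → π ⟨$⟩ʳ k ≢ c
  unseen ¬kc π∈gs πk≡c = ¬kc (lose π∈gs πk≡c)
  same-scores : scores gs σ ≡ scores gs σ′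
  same-scores = scores-≡⁺ gs σ σ′ λ {π} π∈gs → blackPegs-transpose-secret π σ
    (subst (π ⟨$⟩ʳ i ≢_) (sym σi≡a) (unseen ¬ia π∈gs)) (subst (π ⟨$⟩ʳ i ≢_) (sym σj≡b) (unseen ¬ib π∈gs))
    (subst (π ⟨$⟩ʳ j ≢_) (sym σi≡a) (unseen ¬ja π∈gs)) (subst (π ⟨$⟩ʳ j ≢_) (sym σj≡b) (unseen ¬jb π∈gs))

Correct⇒coloursSeen-pair : {gs : List (Perm n)} → Correct gs → {i j : Fin n} → i ≢ j →
                           n ∸ 1 ≤ coloursSeen gs i + coloursSeen gs j
Correct⇒coloursSeen-pair {n} {gs} correct {i} {j} i≢j = begin
  n ∸ 1                                              ≡⟨ *-identityʳ (n ∸ 1) ⟨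
  (n ∸ 1) * 1                                        ≤⟨ sum-all-but-one seenAtEither 1 unseen-unique ⟩
  ∑[ a < n ] (𝟙 (seen? gs i a) + 𝟙 (seen? gs j a))   ≡⟨ ∑-distrib-+ {n} _ _ ⟩
  coloursSeen gs i + coloursSeen gs j                ∎
  where
  open ≤-Reasoning
  seenAtEither : Fin n → ℕ
  seenAtEither a = 𝟙 (seen? gs i a) + 𝟙 (seen? gs j a)
  unseen-unique : ∀ a b → seenAtEither a < 1 → seenAtEither b < 1 → a ≡ b
  unseen-unique a b a-unseen b-unseen =
    Correct⇒unseen-unique correct i≢j (unseenˡ a a-unseen) (unseenʳ a a-unseen)
                                      (unseenˡ b b-unseen) (unseenʳ b b-unseen)
    where
    unseenˡ : ∀ c → seenAtEither c < 1 → ¬ Seen gs i c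
    unseenˡ c c-unseen = 𝟙-none (seen? gs i c) (≤-trans (m≤m+n _ _) (s≤s⁻¹ c-unseen))
    unseenʳ : ∀ c → seenAtEither c < 1 → ¬ Seen gs j c
    unseenʳ c c-unseen = 𝟙-none (seen? gs j c) (≤-trans (m≤n+m _ _) (s≤s⁻¹ c-unseen))

Correct⇒pairsSeen≥ : {gs : List (Perm n)} → Correct gs → (n ∸ 1) * (n ∸ 1) ≤ pairsSeen gs + pairsSeen gs
Correct⇒pairsSeen≥ {n} {gs} correct =
  ≤-trans (sum-all-but-one (λ k → c k + c k) (n ∸ 1) few-unique) (≤-reflexive (∑-distrib-+ {n} c c))
  where
  c = coloursSeen gs
  few-unique : ∀ i j → c i + c i < n ∸ 1 → c j + c j < n ∸ 1 → i ≡ j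
  few-unique i j i-few j-few with i ≟ j
  ... | yes i≡j = i≡j
  ... | no i≢j = ⊥-elim (<-asym cᵢ<cⱼ cⱼ<cᵢ)
    where
    pair = Correct⇒coloursSeen-pair correct i≢j
    cᵢ<cⱼ = +-cancelˡ-< (c i) _ _ (<-≤-trans i-few pair)
    cⱼ<cᵢ = +-cancelˡ-< (c j) _ _ (<-≤-trans j-few (≤-trans pair (≤-reflexive (+-comm (c i) (c j)))))

quadratic-bound : ∀ m T → 7 ≤ m → m * m ≤ (suc m + 2 * T) + (suc m + 2 * T) → suc m ^ 2 ≤ 8 * T
quadratic-bound m T 7≤m m²≤H = +-cancelˡ-≤ (m * m) _ _ (begin
  m * m + suc m ^ 2                  ≡⟨ expand m ⟩
  m * m + m * m + (2 * m + 1)        ≤⟨ +-monoˡ-≤ _ (+-mono-≤ m²≤H m²≤H) ⟩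
  H + H + (2 * m + 1)                ≡⟨ collect m T ⟩
  6 * m + 5 + 8 * T                  ≤⟨ +-monoˡ-≤ (8 * T) 6m+5≤m² ⟩
  m * m + 8 * T                      ∎)
  where
  open ≤-Reasoning
  H = (suc m + 2 * T) + (suc m + 2 * T)
  expand : ∀ m → m * m + suc m * (suc m * 1) ≡ m * m + m * m + (2 * m + 1)
  expand = solve-∀
  collect : ∀ m T → ((suc m + 2 * T) + (suc m + 2 * T)) + ((suc m + 2 * T) + (suc m + 2 * T)) + (2 * m + 1) ≡
                    6 * m + 5 + 8 * T
  collect = solve-∀
  6m+5≤m² : 6 * m + 5 ≤ m * m
  6m+5≤m² = begin
    6 * m + 5   ≤⟨ +-monoʳ-≤ (6 * m) (≤-trans (s≤s (s≤s (s≤s (s≤s (s≤s z≤n))))) 7≤m) ⟩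
    6 * m + m   ≡⟨ +-comm (6 * m) m ⟩
    7 * m       ≤⟨ *-monoˡ-≤ m 7≤m ⟩
    m * m       ∎

lower-bound : 8 ≤ n → {gs : List (Perm n)} → Correct gs → Local 2 gs → n ^ 2 ≤ 8 * length gs
lower-bound {suc m} (s≤s 7≤m) {gs} correct local =
  quadratic-bound m (length gs) 7≤m (≤-trans (Correct⇒pairsSeen≥ correct) (+-mono-≤ pairs≤ pairs≤))
  where pairs≤ = Local⇒pairsSeen≤ 1 gs local

-- The upper bound

data Walk {A : Set} (R : A → A → Set) : A → A → List A → Set where
  [-] : ∀ {x} → Walk R x x (x ∷ [])
  _∷_ : ∀ {x y z xs} → R x y → Walk R y z xs → Walk R x z (x ∷ xs)

walk-++ : ∀ {A : Set} {R : A → A → Set} {x y z w xs ys} →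
          Walk R x y xs → R y z → Walk R z w ys → Walk R x w (xs ++ ys)
walk-++ [-] r walk = r ∷ walk
walk-++ (r′ ∷ walk′) r walk = r′ ∷ walk-++ walk′ r walk

walk-concatMap : ∀ {A B : Set} {R : A → A → Set} {x : A} (f : B → List A) → R x x → (∀ y → Walk R x x (f y)) →
                 ∀ y ys → Walk R x x (concatMap f (y ∷ ys))
walk-concatMap f r walk y [] = subst (Walk _ _ _) (sym (List.++-identityʳ (f y))) (walk y)
walk-concatMap f r walk y (y′ ∷ ys) = walk-++ (walk y) r (walk-concatMap f r walk y′ ys)

walk⇒Local : ∀ {k} {π σ : Perm n} {gs} → Walk (WithinWindow k) π σ gs → Local k gs
walk⇒Local [-] = tt
walk⇒Local (r ∷ [-]) = r , tt
walk⇒Local (r ∷ (r′ ∷ walk)) = r , walk⇒Local (r′ ∷ walk)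

WithinWindow-refl : ∀ {k} {π : Perm n} → WithinWindow k π π
WithinWindow-refl i j πi≢πi _ = ⊥-elim (πi≢πi refl)

WithinWindow-sym : ∀ {k} {π σ : Perm n} → WithinWindow k π σ → WithinWindow k σ π
WithinWindow-sym window i j σi≢πi σj≢πj = window i j (σi≢πi ∘ sym) (σj≢πj ∘ sym)

⊖-≡ : ∀ {a b c d : ℕ} → a + d ≡ c + b → a ⊖ b ≡ c ⊖ d
⊖-≡ {a} {b} {c} {d} a+d≡c+b = begin
  a ⊖ b               ≡⟨ +-cancelˡ-⊖ d a b ⟨
  (d + a) ⊖ (d + b)   ≡⟨ cong₂ _⊖_ (trans (+-comm d a) a+d≡c+b) (+-comm d b) ⟩
  (c + b) ⊖ (b + d)   ≡⟨ cong (_⊖ (b + d)) (+-comm c b) ⟩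
  (b + c) ⊖ (b + d)   ≡⟨ +-cancelˡ-⊖ b c d ⟩
  c ⊖ d               ∎
  where open ≡-Reasoning

differences-agree : ∀ {B B′ : ℕ} {s₁ s₂ t₁ t₂ : ℕ} → B + s₁ ≡ B′ + s₂ → B + t₁ ≡ B′ + t₂ → s₂ + t₁ ≡ s₁ + t₂
differences-agree {B} {B′} {s₁} {s₂} {t₁} {t₂} eqₛ eqₜ = +-cancelˡ-≡ (B + B′) _ _ (begin
  B + B′ + (s₂ + t₁)     ≡⟨ shuffle B B′ s₂ t₁ ⟩
  (B′ + s₂) + (B + t₁)   ≡⟨ cong₂ _+_ (sym eqₛ) eqₜ ⟩
  (B + s₁) + (B′ + t₂)   ≡⟨ interchange B s₁ B′ t₂ ⟩
  B + B′ + (s₁ + t₂)     ∎)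
  where
  open ≡-Reasoning
  shuffle : ∀ B B′ s t → B + B′ + (s + t) ≡ (B′ + s) + (B + t)
  shuffle = solve-∀

Constant : ∀ {A B : Set} → (A → B) → Set
Constant f = ∀ x y → f x ≡ f y

imbalance : (σ τ : Perm n) (k l : Fin n) → Fin n → ℤ
imbalance σ τ k l c = (𝟙 (c ≟ σ ⟨$⟩ʳ k) + 𝟙 (c ≟ τ ⟨$⟩ʳ l)) ⊖ (𝟙 (c ≟ τ ⟨$⟩ʳ k) + 𝟙 (c ≟ σ ⟨$⟩ʳ l))

imbalance-flip : (σ τ : Perm n) (k l c : Fin n) → imbalance σ τ l k c ≡ - imbalance σ τ k l c
imbalance-flip σ τ k l c =
  trans (cong₂ _⊖_ (+-comm (at σ l) (at τ k)) (+-comm (at τ l) (at σ k)))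
        (⊖-swap (at τ k + at σ l) (at σ k + at τ l))
  where
  at : Perm _ → Fin _ → ℕ
  at π i = 𝟙 (c ≟ π ⟨$⟩ʳ i)

imbalance-exchange : (σ τ ρ : Perm n) {k l : Fin n} → k ≢ l →
  blackPegs ρ σ ≡ blackPegs ρ τ → blackPegs (transpose k l ∘ₚ ρ) σ ≡ blackPegs (transpose k l ∘ₚ ρ) τ →
  imbalance σ τ k l (ρ ⟨$⟩ʳ k) ≡ imbalance σ τ k l (ρ ⟨$⟩ʳ l)
imbalance-exchange σ τ ρ {k} {l} k≢l same same′ = ⊖-≡ {σku + τlu} {τku + σlu} {σkv + τlv} {τkv + σlv} (begin
  (σku + τlu) + (τkv + σlv)    ≡⟨ swap-2-4 σku τlu τkv σlv ⟩
  (σku + σlv) + (τkv + τlu)    ≡⟨ differences-agree {blackPegs ρ σ} {blackPegs ρ′ σ} {σkv + σlu} {σku + σlv}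
                                   {τkv + τlu} {τku + τlv} (blackPegs-transpose ρ σ k≢l) τ-offset ⟩
  (σkv + σlu) + (τku + τlv)    ≡⟨ swap-2-4 σkv σlu τku τlv ⟩
  (σkv + τlv) + (τku + σlu)    ∎)
  where
  open ≡-Reasoning
  ρ′ = transpose k l ∘ₚ ρ
  u = ρ ⟨$⟩ʳ k
  v = ρ ⟨$⟩ʳ l
  σku σkv σlu σlv τku τkv τlu τlv : ℕ
  σku = 𝟙 (u ≟ σ ⟨$⟩ʳ k)
  σkv = 𝟙 (v ≟ σ ⟨$⟩ʳ k)
  σlu = 𝟙 (u ≟ σ ⟨$⟩ʳ l)
  σlv = 𝟙 (v ≟ σ ⟨$⟩ʳ l)
  τku = 𝟙 (u ≟ τ ⟨$⟩ʳ k)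
  τkv = 𝟙 (v ≟ τ ⟨$⟩ʳ k)
  τlu = 𝟙 (u ≟ τ ⟨$⟩ʳ l)
  τlv = 𝟙 (v ≟ τ ⟨$⟩ʳ l)
  τ-offset : blackPegs ρ σ + (τkv + τlu) ≡ blackPegs ρ′ σ + (τku + τlv)
  τ-offset = subst₂ (λ b b′ → b + (τkv + τlu) ≡ b′ + (τku + τlv)) (sym same) (sym same′)
                    (blackPegs-transpose ρ τ k≢l)
  swap-2-4 : ∀ a b c d → (a + b) + (c + d) ≡ (a + d) + (c + b)
  swap-2-4 = solve-∀

imbalance-constant⇒agree : (σ τ : Perm n) {k l : Fin n} → k ≢ l →
                           Constant (imbalance σ τ k l) → σ ⟨$⟩ʳ k ≡ τ ⟨$⟩ʳ k
imbalance-constant⇒agree σ τ {k} {l} k≢l constant with σ ⟨$⟩ʳ k ≟ τ ⟨$⟩ʳ k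
... | yes σk≡τk = σk≡τk
... | no σk≢τk = ⊥-elim (positive≢negative (trans (sym at-σk) (trans (constant σk τk) at-τk)))
  where
  σk = σ ⟨$⟩ʳ k
  τk = τ ⟨$⟩ʳ k
  σl = σ ⟨$⟩ʳ l
  τl = τ ⟨$⟩ʳ l
  positive≢negative : ∀ {x y} → suc x ⊖ 0 ≢ 0 ⊖ suc y
  positive≢negative ()
  at-σk : imbalance σ τ k l σk ≡ suc (𝟙 (σk ≟ τl)) ⊖ 0
  at-σk = cong₂ _⊖_ (cong (_+ 𝟙 (σk ≟ τl)) (𝟙-yes (σk ≟ σk) refl))
                    (cong₂ _+_ (𝟙-no (σk ≟ τk) σk≢τk) (𝟙-no (σk ≟ σl) (k≢l ∘ ⟨$⟩ʳ-injective σ)))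
  at-τk : imbalance σ τ k l τk ≡ 0 ⊖ suc (𝟙 (τk ≟ σl))
  at-τk = cong₂ _⊖_ (cong₂ _+_ (𝟙-no (τk ≟ σk) (σk≢τk ∘ sym)) (𝟙-no (τk ≟ τl) (k≢l ∘ ⟨$⟩ʳ-injective τ)))
                    (cong (_+ 𝟙 (τk ≟ σl)) (𝟙-yes (τk ≟ τk) refl))

private
  variable
    m : ℕ

swapAt : Fin m → Perm (suc m) → Perm (suc m)
swapAt p π = transpose (inject₁ p) (fsuc p) ∘ₚ π

inject₁<suc : (p : Fin m) → toℕ (inject₁ p) < toℕ (fsuc p)
inject₁<suc p = s≤s (≤-reflexive (toℕ-inject₁ p))

swapAt-within : (p : Fin m) (π : Perm (suc m)) → WithinWindow 2 π (swapAt p π)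
swapAt-within p π i j i-moved j-moved = begin
  toℕ j             ≤⟨ proj₂ (near (moved-by-transpose π j-moved)) ⟩
  suc (toℕ p)       ≤⟨ s≤s (proj₁ (near (moved-by-transpose π i-moved))) ⟩
  suc (toℕ i)       ≡⟨ +-comm 1 (toℕ i) ⟩
  toℕ i + 1         ∎
  where
  open ≤-Reasoning
  near : ∀ {x} → x ≡ inject₁ p ⊎ x ≡ fsuc p → toℕ p ≤ toℕ x × toℕ x ≤ suc (toℕ p)
  near (inj₁ refl) = ≤-reflexive (sym (toℕ-inject₁ p)) , ≤-trans (≤-reflexive (toℕ-inject₁ p)) (n≤1+n _)
  near (inj₂ refl) = n≤1+n _ , ≤-refl

excursion : List (Fin m) → Perm (suc m) → List (Perm (suc m))
excursion [] π = π ∷ []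
excursion (p ∷ ps) π = π ∷ excursion ps (swapAt p π) ++ π ∷ []

excursion-start : (ps : List (Fin m)) (π : Perm (suc m)) → π ∈ excursion ps π
excursion-start [] π = here refl
excursion-start (p ∷ ps) π = here refl

excursion-walk : (ps : List (Fin m)) (π : Perm (suc m)) → Walk (WithinWindow 2) π π (excursion ps π)
excursion-walk [] π = [-]
excursion-walk (p ∷ ps) π =
  swapAt-within p π ∷ walk-++ (excursion-walk ps (swapAt p π)) back [-]
  where
  back : WithinWindow 2 (swapAt p π) π
  back = WithinWindow-sym {k = 2} {π} {swapAt p π} (swapAt-within p π)

excursion-length : (ps : List (Fin m)) (π : Perm (suc m)) → length (excursion ps π) ≡ suc (2 * length ps)
excursion-length [] π = refl
excursion-length (p ∷ ps) π = cong suc (begin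
  length (excursion ps (swapAt p π) ++ π ∷ [])   ≡⟨ List.length-++ (excursion ps (swapAt p π)) ⟩
  length (excursion ps (swapAt p π)) + 1         ≡⟨ cong (_+ 1) (excursion-length ps (swapAt p π)) ⟩
  suc (2 * length ps) + 1                        ≡⟨ two-more (length ps) ⟩
  2 * suc (length ps)                            ∎)
  where
  open ≡-Reasoning
  two-more : ∀ L → suc (2 * L) + 1 ≡ 2 * suc L
  two-more = solve-∀

Exchanges : List (Perm (suc m)) → Fin m → Fin (suc m) → Fin (suc m) → Set
Exchanges gs p u v = ∃ λ ρ → ρ ∈ gs × swapAt p ρ ∈ gs × ρ ⟨$⟩ʳ inject₁ p ≡ u × ρ ⟨$⟩ʳ fsuc p ≡ v

Exchanges-⊆ : {gs hs : List (Perm (suc m))} {p : Fin m} {u v : Fin (suc m)} →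
              gs ⊆ hs → Exchanges gs p u v → Exchanges hs p u v
Exchanges-⊆ gs⊆hs (ρ , ρ∈gs , ρ′∈gs , ρk≡u , ρl≡v) = ρ , gs⊆hs ρ∈gs , gs⊆hs ρ′∈gs , ρk≡u , ρl≡v

-- Ascent q ps: the adjacent swaps ps, performed in order, carry the entry at position q to the
-- last position.  Descent q ps: to position 0.
data Ascent {m : ℕ} : Fin (suc m) → List (Fin m) → Set where
  [] : Ascent (fromℕ m) []
  _∷_ : ∀ p {ps} → Ascent (fsuc p) ps → Ascent (inject₁ p) (p ∷ ps)

data Descent {m : ℕ} : Fin (suc m) → List (Fin m) → Set where
  [] : Descent fzero []
  _∷_ : ∀ p {ps} → Descent (inject₁ p) ps → Descent (fsuc p) (p ∷ ps)

ascent-suc : {q : Fin (suc m)} {ps : List (Fin m)} → Ascent q ps → Ascent (fsuc q) (map fsuc ps)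
ascent-suc [] = []
ascent-suc (p ∷ ascent) = fsuc p ∷ ascent-suc ascent

descent-inject₁ : {q : Fin (suc m)} {ps : List (Fin m)} → Descent q ps → Descent (inject₁ q) (map inject₁ ps)
descent-inject₁ [] = []
descent-inject₁ (p ∷ descent) = inject₁ p ∷ descent-inject₁ descent

ascent : (q : Fin (suc m)) → ∃ (Ascent q)
ascent {zero} fzero = [] , []
ascent {suc m} fzero = Product.map (λ ps → fzero ∷ map fsuc ps) (λ a → fzero ∷ ascent-suc a) (ascent {m} fzero)
ascent {suc m} (fsuc q) = Product.map (map fsuc) ascent-suc (ascent q)

descent : (q : Fin (suc m)) → ∃ (Descent q)
descent fzero = [] , []
descent {suc m} (fsuc p) = Product.map (λ ps → p ∷ map inject₁ ps) (λ d → p ∷ descent-inject₁ d) (descent p)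

ascent-length : {q : Fin (suc m)} {ps : List (Fin m)} → Ascent q ps → length ps + toℕ q ≡ m
ascent-length {m} [] = toℕ-fromℕ m
ascent-length (p ∷ ascent) =
  trans (cong (suc _ +_) (toℕ-inject₁ p)) (trans (sym (+-suc _ _)) (ascent-length ascent))

descent-length : {q : Fin (suc m)} {ps : List (Fin m)} → Descent q ps → length ps ≡ toℕ q
descent-length [] = refl
descent-length (p ∷ descent) = cong suc (trans (descent-length descent) (toℕ-inject₁ p))

ascent-exchanges : {q : Fin (suc m)} {ps : List (Fin m)} → Ascent q ps →
  {π : Perm (suc m)} {c : Fin (suc m)} → π ⟨$⟩ʳ q ≡ c → (∀ k → toℕ q < toℕ k → π ⟨$⟩ʳ k ≡ k) →
  (p : Fin m) → toℕ q ≤ toℕ p → Exchanges (excursion ps π) p c (fsuc p)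
ascent-exchanges {m} [] _ _ p m≤p = ⊥-elim (<⇒≱ (toℕ<n p) (subst (_≤ toℕ p) (toℕ-fromℕ m) m≤p))
ascent-exchanges (_∷_ p′ {ps} ascent) {π} πq≡c fixed p q≤p with p′ ≟ p
... | yes refl =
  π , here refl , there (∈-++⁺ˡ (excursion-start ps (swapAt p π))) , πq≡c , fixed (fsuc p) (inject₁<suc p)
... | no p′≢p = Exchanges-⊆ (there ∘ ∈-++⁺ˡ) (ascent-exchanges ascent π′q′≡c fixed′ p q′≤p)
  where
  π′ = swapAt p′ π
  π′q′≡c : π′ ⟨$⟩ʳ fsuc p′ ≡ _
  π′q′≡c = trans (cong (π ⟨$⟩ʳ_) (transpose-right (inject₁ p′) (fsuc p′))) πq≡c
  fixed′ : ∀ k → toℕ (fsuc p′) < toℕ k → π′ ⟨$⟩ʳ k ≡ k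
  fixed′ k p′+1<k = trans (cong (π ⟨$⟩ʳ_) (transpose-other (<⇒≢ q<k ∘ sym) (<⇒≢ p′+1<k ∘ sym))) (fixed k q<k)
    where q<k = <-trans (inject₁<suc p′) p′+1<k
  q′≤p : toℕ (fsuc p′) ≤ toℕ p
  q′≤p = ≤∧≢⇒< (≤-trans (≤-reflexive (sym (toℕ-inject₁ p′))) q≤p) (p′≢p ∘ toℕ-injective)

descent-exchanges : {q : Fin (suc m)} {ps : List (Fin m)} → Descent q ps →
  {π : Perm (suc m)} {c : Fin (suc m)} → π ⟨$⟩ʳ q ≡ c → (∀ k → toℕ k < toℕ q → π ⟨$⟩ʳ k ≡ k) →
  (p : Fin m) → toℕ p < toℕ q → Exchanges (excursion ps π) p (inject₁ p) c
descent-exchanges (_∷_ p′ {ps} descent) {π} πq≡c fixed p p<q with p′ ≟ p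
... | yes refl =
  π , here refl , there (∈-++⁺ˡ (excursion-start ps (swapAt p π))) , fixed (inject₁ p) (inject₁<suc p) , πq≡c
... | no p′≢p = Exchanges-⊆ (there ∘ ∈-++⁺ˡ) (descent-exchanges descent π′q′≡c fixed′ p p<q′)
  where
  π′ = swapAt p′ π
  π′q′≡c : π′ ⟨$⟩ʳ inject₁ p′ ≡ _
  π′q′≡c = trans (cong (π ⟨$⟩ʳ_) (transpose-left (inject₁ p′) (fsuc p′))) πq≡c
  fixed′ : ∀ k → toℕ k < toℕ (inject₁ p′) → π′ ⟨$⟩ʳ k ≡ k
  fixed′ k k<q′ = trans (cong (π ⟨$⟩ʳ_) (transpose-other (<⇒≢ k<q′) (<⇒≢ k<q))) (fixed k k<q)
    where k<q = <-trans k<q′ (inject₁<suc p′)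
  p<q′ : toℕ p < toℕ (inject₁ p′)
  p<q′ = ≤-trans (≤∧≢⇒< (s≤s⁻¹ p<q) (p′≢p ∘ sym ∘ toℕ-injective)) (≤-reflexive (sym (toℕ-inject₁ p′)))

block : Fin (suc m) → List (Perm (suc m))
block c = excursion (proj₁ (ascent c)) id ++ excursion (proj₁ (descent c)) id

strategy : (m : ℕ) → List (Perm (suc m))
strategy m = concatMap block (allFin (suc m))

length-concatMap : ∀ {A B : Set} (f : A → List B) {k : ℕ} → (∀ x → length (f x) ≡ k) →
                   (xs : List A) → length (concatMap f xs) ≡ length xs * k
length-concatMap f length-f [] = refl
length-concatMap f length-f (x ∷ xs) =
  trans (List.length-++ (f x)) (cong₂ _+_ (length-f x) (length-concatMap f length-f xs))

block-length : (c : Fin (suc m)) → length (block c) ≡ 2 * suc m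
block-length {m} c = begin
  length (block c)
    ≡⟨ List.length-++ (excursion up id) ⟩
  length (excursion up id) + length (excursion down id)
    ≡⟨ cong₂ _+_ (excursion-length up id) (excursion-length down id) ⟩
  suc (2 * length up) + suc (2 * length down)
    ≡⟨ regroup (length up) (length down) ⟩
  2 * suc (length up + length down)
    ≡⟨ cong (λ d → 2 * suc (length up + d)) (descent-length (proj₂ (descent c))) ⟩
  2 * suc (length up + toℕ c)
    ≡⟨ cong (λ s → 2 * suc s) (ascent-length (proj₂ (ascent c))) ⟩
  2 * suc m
    ∎
  where
  open ≡-Reasoning
  up = proj₁ (ascent c)
  down = proj₁ (descent c)
  regroup : ∀ a d → suc (2 * a) + suc (2 * d) ≡ 2 * suc (a + d)
  regroup = solve-∀

strategy-length : length (strategy m) ≤ 2 * suc m ^ 2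
strategy-length {m} = ≤-reflexive (begin
  length (strategy m)                    ≡⟨ length-concatMap block block-length (allFin (suc m)) ⟩
  length (allFin (suc m)) * (2 * suc m)  ≡⟨ cong (_* (2 * suc m)) (List.length-tabulate {n = suc m} (λ c → c)) ⟩
  suc m * (2 * suc m)                    ≡⟨ reorder (suc m) ⟩
  2 * suc m ^ 2                          ∎)
  where
  open ≡-Reasoning
  reorder : ∀ n → n * (2 * n) ≡ 2 * (n * (n * 1))
  reorder = solve-∀

strategy-walk : Walk (WithinWindow 2) id id (strategy m)
strategy-walk {m} = walk-concatMap block (WithinWindow-refl {k = 2} {π = id}) block-walk fzero (tabulate fsuc)
  where
  block-walk : ∀ c → Walk (WithinWindow 2) id id (block c)
  block-walk c = walk-++ (excursion-walk (proj₁ (ascent c)) id) (WithinWindow-refl {k = 2} {π = id})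
                         (excursion-walk (proj₁ (descent c)) id)

block⊆strategy : (c : Fin (suc m)) → block c ⊆ strategy m
block⊆strategy c π∈block = ∈-concat⁺′ π∈block (∈-map⁺ block (∈-allFin c))

strategy-exchanges-up : {c : Fin (suc m)} (p : Fin m) → toℕ c ≤ toℕ p → Exchanges (strategy m) p c (fsuc p)
strategy-exchanges-up {c = c} p c≤p =
  Exchanges-⊆ (block⊆strategy c ∘ ∈-++⁺ˡ) (ascent-exchanges (proj₂ (ascent c)) refl (λ _ _ → refl) p c≤p)

strategy-exchanges-down : {c : Fin (suc m)} (p : Fin m) → toℕ p < toℕ c → Exchanges (strategy m) p (inject₁ p) c
strategy-exchanges-down {c = c} p p<c =
  Exchanges-⊆ (block⊆strategy c ∘ ∈-++⁺ʳ _) (descent-exchanges (proj₂ (descent c)) refl (λ _ _ → refl) p p<c)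

exchange⇒imbalance≡ : {σ τ : Perm (suc m)} {gs : List (Perm (suc m))} {p : Fin m} {u v : Fin (suc m)} →
  scores gs σ ≡ scores gs τ → Exchanges gs p u v →
  imbalance σ τ (inject₁ p) (fsuc p) u ≡ imbalance σ τ (inject₁ p) (fsuc p) v
exchange⇒imbalance≡ {σ = σ} {τ} {gs} {p} same (ρ , ρ∈gs , ρ′∈gs , refl , refl) =
  imbalance-exchange σ τ ρ (<⇒≢ (inject₁<suc p)) (scores-≡⁻ gs σ τ same ρ∈gs)
                                                 (scores-≡⁻ gs σ τ same ρ′∈gs)

strategy-imbalance-constant : {σ τ : Perm (suc m)} → scores (strategy m) σ ≡ scores (strategy m) τ →
  (p : Fin m) → Constant (imbalance σ τ (inject₁ p) (fsuc p))
strategy-imbalance-constant {m} {σ} {τ} same p u v = trans (towards-p u) (sym (towards-p v))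
  where
  I = imbalance σ τ (inject₁ p) (fsuc p)
  imbalance≡ : ∀ {u v} → Exchanges (strategy m) p u v → I u ≡ I v
  imbalance≡ = exchange⇒imbalance≡ {σ = σ} {τ} {strategy m} same
  towards-p : ∀ c → I c ≡ I (inject₁ p)
  towards-p c with toℕ c ≤? toℕ p
  ... | yes c≤p = trans (imbalance≡ (strategy-exchanges-up p c≤p))
                        (sym (imbalance≡ (strategy-exchanges-up p (≤-reflexive (toℕ-inject₁ p)))))
  ... | no c≰p = sym (imbalance≡ (strategy-exchanges-down p (≰⇒> c≰p)))

strategy-injective : {σ τ : Perm (suc m)} → scores (strategy m) σ ≡ scores (strategy m) τ → σ ≈ₚ τ
strategy-injective {zero} {σ} {τ} same fzero with σ ⟨$⟩ʳ fzero | τ ⟨$⟩ʳ fzero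
... | fzero | fzero = refl
strategy-injective {suc m} {σ} {τ} same fzero =
  imbalance-constant⇒agree σ τ (<⇒≢ (inject₁<suc {suc m} fzero))
                           (strategy-imbalance-constant {suc m} {σ} {τ} same fzero)
strategy-injective {m} {σ} {τ} same (fsuc p) = imbalance-constant⇒agree σ τ (<⇒≢ (inject₁<suc p) ∘ sym) flipped
  where
  flipped : Constant (imbalance σ τ (fsuc p) (inject₁ p))
  flipped u v = begin
    imbalance σ τ (fsuc p) (inject₁ p) u    ≡⟨ imbalance-flip σ τ _ _ u ⟩
    - imbalance σ τ (inject₁ p) (fsuc p) u  ≡⟨ cong -_ (strategy-imbalance-constant {m} {σ} {τ} same p u v) ⟩
    - imbalance σ τ (inject₁ p) (fsuc p) v  ≡⟨ imbalance-flip σ τ _ _ v ⟨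
    imbalance σ τ (fsuc p) (inject₁ p) v    ∎
    where open ≡-Reasoning

upper-bound : (n : ℕ) → ∃ λ (gs : List (Perm n)) → Correct gs × Local 2 gs × length gs ≤ 2 * n ^ 2
upper-bound zero = [] , injective⇒Correct {gs = []} (λ _ ()) , tt , z≤n
upper-bound (suc m) =
  strategy m , injective⇒Correct (λ {σ} {τ} → strategy-injective {m} {σ} {τ}) ,
  walk⇒Local (strategy-walk {m}) , strategy-length {m}

theorem3 : ∃ λ (N : ℕ) → ∃ λ (d : ℕ) → ∃ λ (C : ℕ) →
    1 ≤ d × 1 ≤ C ×
    (∀ (n : ℕ) → 2 ≤ n → N ≤ n →
      ((∀ (gs : List (Perm n)) → Correct gs → Local 2 gs → n ^ 2 ≤ d * length gs)
      × ∃ λ (gs : List (Perm n)) → Correct gs × Local 2 gs × length gs ≤ C * n ^ 2))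
theorem3 = 8 , 8 , 2 , s≤s z≤n , s≤s z≤n , λ n _ 8≤n → (λ gs → lower-bound 8≤n) , upper-bound n
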